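{- Let $k\ge 1$ and let $u\in\{1,2,\ldots,k\}^+$ be a nonempty word. Then $u$ is a factor (contiguous subword) of the Zimin word $Z_k$ if and only if for every $j$ with $1\le j\le k$, the sequence obtained from $u$ by deleting all letters smaller than $j$ is $j$-interleaved.
   Context: Zimin words are defined by $Z_1=1$ and $Z_k=Z_{k-1}\,k\,Z_{k-1}$ for $k\ge 2$ (words over the alphabet of positive integers), e.g. $Z_3=1213121$. A sequence $v$ is called $j$-interleaved if for each two adjacent elements of $v$ exactly one of them equals $j$ (sequences of length at most one are vacuously $j$-interleaved). -}

module Defs where

open import Data.Nat using (ℕ; zero; suc; _≤_; _≤?_)
open import Data.List using (List; []; _∷_; _++_; [_]; filter)
open import Data.Product using (_×_; Σ)
open import Data.Sum using (_⊎_)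
open import Relation.Nullary using (¬_)
open import Relation.Binary.PropositionalEquality using (_≡_; _≢_)

-- Zimin words: Z 1 = 1, Z k = Z (k-1) k Z (k-1).
-- We set Z 0 = [] (empty word) for convenience; only k ≥ 1 is used in the statement.
Zimin : ℕ → List ℕ
Zimin zero = []
Zimin (suc zero) = [ 1 ]
Zimin (suc (suc k)) = Zimin (suc k) ++ (suc (suc k) ∷ Zimin (suc k))

IsFactor : List ℕ → List ℕ → Set
IsFactor u w = Σ (List ℕ) (λ xs → Σ (List ℕ) (λ ys → xs ++ u ++ ys ≡ w))

ExactlyOne : ℕ → ℕ → ℕ → Set
ExactlyOne j a b = (a ≡ j × b ≢ j) ⊎ (a ≢ j × b ≡ j)

data Interleaved (j : ℕ) : List ℕ → Set where
  nil  : Interleaved j []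
  one  : ∀ a → Interleaved j (a ∷ [])
  cons : ∀ a b v → ExactlyOne j a b → Interleaved j (b ∷ v) → Interleaved j (a ∷ b ∷ v)

deleteBelow : ℕ → List ℕ → List ℕ
deleteBelow j = filter (j ≤?_)

module Submission where

-- Let  expand w = 1 (w₁+1) 1 (w₂+1) 1 … 1 (wₙ+1) 1  insert a 1
-- around every letter of w and raise the old letters by one; then
-- Z (k+1) = expand (Z k).  Its partial inverse  contract  deletes the letters
-- 0 and 1 and lowers the others by one.  Call u k-layered if, for 1 ≤ j ≤ k,
-- the letters ≥ j of u form a j-interleaved sequence.  Layers of expand w and
-- contract u are related by  deleteBelow (j+1) u = map suc (deleteBelow j (contract u)),
-- and interleaving is invariant under the injective map suc.
--   (⇒) expand raises the layering depth by one, so Z k is k-layered; layering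
--       passes to factors because deleteBelow commutes with _++_ and
--       interleaving passes to infixes.
--   (⇐) induction on k.  A 1-interleaved word u is a factor of
--       expand (contract u); contract u is again layered one level lower, so it
--       is a factor of Z k, and expand preserves factors.
-- Neither direction needs k ≥ 1 or u nonempty.

open import Defs
open import Data.Nat using (ℕ; zero; suc; _≤_; z≤n; s≤s; _≤?_)
open import Data.Nat.Properties using (suc-injective)
open import Data.List using (List; []; _∷_; _++_; [_]; map; concatMap)
open import Data.List.Properties using (++-assoc; concatMap-++; filter-accept; filter-reject; filter-++; filter-all)
open import Data.List.Relation.Unary.All as All using (All; []; _∷_)
open import Data.Product using (Σ; _×_; _,_; proj₁)
open import Data.Sum using (inj₁; inj₂)
open import Data.Empty using (⊥-elim)
open import Function.Bundles using (_⇔_; mk⇔)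
open import Function.Definitions using (Injective)
open import Relation.Nullary using (yes; no)
open import Relation.Binary.PropositionalEquality
  using (_≡_; _≢_; refl; sym; trans; cong; subst)
open Relation.Binary.PropositionalEquality.≡-Reasoning

factor-trans : ∀ {u v w : List ℕ} → IsFactor u v → IsFactor v w → IsFactor u w
factor-trans {u} (p , s , refl) (q , t , refl) = q ++ p , s ++ t , (begin
  (q ++ p) ++ u ++ s ++ t    ≡⟨ ++-assoc q p (u ++ s ++ t) ⟩
  q ++ p ++ u ++ s ++ t      ≡⟨ cong (λ z → q ++ p ++ z) (sym (++-assoc u s t)) ⟩
  q ++ p ++ (u ++ s) ++ t    ≡⟨ cong (q ++_) (sym (++-assoc p (u ++ s) t)) ⟩
  q ++ (p ++ u ++ s) ++ t    ∎)

interleaved-tail : ∀ {j x w} → Interleaved j (x ∷ w) → Interleaved j w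
interleaved-tail (one _)            = nil
interleaved-tail (cons _ _ _ _ rest) = rest

interleaved-suffix : ∀ {j} xs {ys} → Interleaved j (xs ++ ys) → Interleaved j ys
interleaved-suffix []       i = i
interleaved-suffix (x ∷ xs) i = interleaved-suffix xs (interleaved-tail i)

interleaved-prefix : ∀ {j} xs {ys} → Interleaved j (xs ++ ys) → Interleaved j xs
interleaved-prefix []           i                   = nil
interleaved-prefix (x ∷ [])     i                   = one x
interleaved-prefix (x ∷ y ∷ xs) (cons _ _ _ e rest) = cons x y xs e (interleaved-prefix (y ∷ xs) rest)

interleaved-infix : ∀ {j} xs ys zs → Interleaved j (xs ++ ys ++ zs) → Interleaved j ys
interleaved-infix xs ys zs i = interleaved-prefix ys (interleaved-suffix xs i)

module _ {f : ℕ → ℕ} (f-inj : Injective _≡_ _≡_ f) where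

  exactlyOne-map : ∀ {j a b} → ExactlyOne j a b → ExactlyOne (f j) (f a) (f b)
  exactlyOne-map (inj₁ (a≡j , b≢j)) = inj₁ (cong f a≡j , λ e → b≢j (f-inj e))
  exactlyOne-map (inj₂ (a≢j , b≡j)) = inj₂ ((λ e → a≢j (f-inj e)) , cong f b≡j)

  exactlyOne-unmap : ∀ {j a b} → ExactlyOne (f j) (f a) (f b) → ExactlyOne j a b
  exactlyOne-unmap (inj₁ (a≡j , b≢j)) = inj₁ (f-inj a≡j , λ e → b≢j (cong f e))
  exactlyOne-unmap (inj₂ (a≢j , b≡j)) = inj₂ ((λ e → a≢j (cong f e)) , f-inj b≡j)

  interleaved-map : ∀ {j} v → Interleaved j v → Interleaved (f j) (map f v)
  interleaved-map []          _                   = nil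
  interleaved-map (x ∷ [])    _                   = one (f x)
  interleaved-map (x ∷ y ∷ v) (cons _ _ _ e rest) =
    cons (f x) (f y) (map f v) (exactlyOne-map e) (interleaved-map (y ∷ v) rest)

  interleaved-unmap : ∀ {j} v → Interleaved (f j) (map f v) → Interleaved j v
  interleaved-unmap []          _                   = nil
  interleaved-unmap (x ∷ [])    _                   = one x
  interleaved-unmap (x ∷ y ∷ v) (cons _ _ _ e rest) =
    cons x y v (exactlyOne-unmap e) (interleaved-unmap (y ∷ v) rest)

Layered : ℕ → List ℕ → Set
Layered k u = (j : ℕ) → 1 ≤ j → j ≤ k → Interleaved j (deleteBelow j u)

factor-layered : ∀ {k u w} → IsFactor u w → Layered k w → Layered k u
factor-layered {u = u} (p , s , refl) layered j 1≤j j≤k =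
  interleaved-infix (deleteBelow j p) (deleteBelow j u) (deleteBelow j s)
    (subst (Interleaved j) layers (layered j 1≤j j≤k))
  where
  layers : deleteBelow j (p ++ u ++ s) ≡ deleteBelow j p ++ deleteBelow j u ++ deleteBelow j s
  layers = trans (filter-++ (j ≤?_) p (u ++ s)) (cong (deleteBelow j p ++_) (filter-++ (j ≤?_) u s))

Positive : List ℕ → Set
Positive = All (1 ≤_)

deleteBelow-one : ∀ {u} → Positive u → deleteBelow 1 u ≡ u
deleteBelow-one = filter-all (1 ≤?_)

-- expand w = 1 ∷ (w₁+1) ∷ 1 ∷ … ∷ (wₙ+1) ∷ 1; definitionally
-- expand (x ∷ w) = 1 ∷ suc x ∷ expand w.
raiseThenOne : ℕ → List ℕ
raiseThenOne x = suc x ∷ 1 ∷ []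

expand : List ℕ → List ℕ
expand w = 1 ∷ concatMap raiseThenOne w

contract : List ℕ → List ℕ
contract []                = []
contract (zero ∷ u)        = contract u
contract (suc zero ∷ u)    = contract u
contract (suc (suc y) ∷ u) = suc y ∷ contract u

contract-expand : ∀ {w} → Positive w → contract (expand w) ≡ w
contract-expand []                = refl
contract-expand (s≤s z≤n ∷ 1≤ws) = cong (_ ∷_) (contract-expand 1≤ws)

expand-positive : ∀ w → Positive (expand w)
expand-positive []      = s≤s z≤n ∷ []
expand-positive (x ∷ w) = s≤s z≤n ∷ s≤s z≤n ∷ expand-positive w

expand-insert : ∀ a x b → expand (a ++ x ∷ b) ≡ expand a ++ suc x ∷ expand b
expand-insert []      x b = refl
expand-insert (y ∷ a) x b = cong (λ t → 1 ∷ suc y ∷ t) (expand-insert a x b)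

Zimin-expand : ∀ k → Zimin (suc k) ≡ expand (Zimin k)
Zimin-expand zero          = refl
Zimin-expand (suc zero)    = refl
Zimin-expand (suc (suc k)) = begin
  Zimin (suc (suc k)) ++ suc (suc (suc k)) ∷ Zimin (suc (suc k))
    ≡⟨ cong (λ z → z ++ suc (suc (suc k)) ∷ z) (Zimin-expand (suc k)) ⟩
  expand (Zimin (suc k)) ++ suc (suc (suc k)) ∷ expand (Zimin (suc k))
    ≡⟨ sym (expand-insert (Zimin (suc k)) (suc (suc k)) (Zimin (suc k))) ⟩
  expand (Zimin (suc (suc k))) ∎

factor-expand : ∀ {v w} → IsFactor v w → IsFactor (expand v) (expand w)
factor-expand {v} (p , s , refl) = go p
  where
  go : ∀ p → IsFactor (expand v) (expand (p ++ v ++ s))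
  go []      = [] , concatMap raiseThenOne s , sym (cong (1 ∷_) (concatMap-++ raiseThenOne v s))
  go (x ∷ p) with go p
  ... | q , r , e = 1 ∷ suc x ∷ q , r , cong (λ t → 1 ∷ suc x ∷ t) e

deleteBelow-contract : ∀ {j} → 1 ≤ j → ∀ u → deleteBelow (suc j) u ≡ map suc (deleteBelow j (contract u))
deleteBelow-contract     1≤j [] = refl
deleteBelow-contract {j} 1≤j (zero ∷ u) =
  trans (filter-reject (suc j ≤?_) {zero} {u} λ ()) (deleteBelow-contract 1≤j u)
deleteBelow-contract {j} (s≤s z≤n) (suc zero ∷ u) =
  trans (filter-reject (suc j ≤?_) {suc zero} {u} λ { (s≤s ()) }) (deleteBelow-contract (s≤s z≤n) u)
deleteBelow-contract {j} 1≤j (suc (suc y) ∷ u) with j ≤? suc y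
... | yes j≤y = begin
  deleteBelow (suc j) (suc (suc y) ∷ u)     ≡⟨ filter-accept (suc j ≤?_) {suc (suc y)} {u} (s≤s j≤y) ⟩
  suc (suc y) ∷ deleteBelow (suc j) u       ≡⟨ cong (suc (suc y) ∷_) (deleteBelow-contract 1≤j u) ⟩
  map suc (suc y ∷ deleteBelow j (contract u)) ≡⟨ cong (map suc) (sym (filter-accept (j ≤?_) {suc y} {contract u} j≤y)) ⟩
  map suc (deleteBelow j (suc y ∷ contract u)) ∎
... | no j≰y = begin
  deleteBelow (suc j) (suc (suc y) ∷ u)     ≡⟨ filter-reject (suc j ≤?_) {suc (suc y)} {u} (λ { (s≤s j≤y) → j≰y j≤y }) ⟩
  deleteBelow (suc j) u                     ≡⟨ deleteBelow-contract 1≤j u ⟩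
  map suc (deleteBelow j (contract u))      ≡⟨ cong (map suc) (sym (filter-reject (j ≤?_) {suc y} {contract u} j≰y)) ⟩
  map suc (deleteBelow j (suc y ∷ contract u)) ∎

expand-interleaved : ∀ {w} → Positive w → Interleaved 1 (expand w)
expand-interleaved {[]}    _                  = one 1
expand-interleaved {x ∷ w} (s≤s z≤n ∷ 1≤ws) =
  cons 1 (suc x) _ (inj₁ (refl , λ ())) (cons (suc x) 1 _ (inj₂ ((λ ()) , refl)) (expand-interleaved 1≤ws))

expand-layered : ∀ {k w} → Positive w → Layered k w → Layered (suc k) (expand w)
expand-layered {w = w} 1≤ws layered (suc zero) _ _ =
  subst (Interleaved 1) (sym (deleteBelow-one (expand-positive w))) (expand-interleaved 1≤ws)
expand-layered {w = w} 1≤ws layered (suc (suc j)) _ (s≤s j<k) =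
  subst (Interleaved (suc (suc j))) (sym layers)
    (interleaved-map suc-injective _ (layered (suc j) (s≤s z≤n) j<k))
  where
  layers : deleteBelow (suc (suc j)) (expand w) ≡ map suc (deleteBelow (suc j) w)
  layers = trans (deleteBelow-contract (s≤s z≤n) (expand w))
                 (cong (λ t → map suc (deleteBelow (suc j) t)) (contract-expand 1≤ws))

contract-layered : ∀ {k u} → Layered (suc k) u → Layered k (contract u)
contract-layered {u = u} layered j 1≤j j≤k =
  interleaved-unmap suc-injective _
    (subst (Interleaved (suc j)) (deleteBelow-contract 1≤j u) (layered (suc j) (s≤s z≤n) (s≤s j≤k)))

Zimin-positive : ∀ k → Positive (Zimin k)
Zimin-positive zero    = []
Zimin-positive (suc k) = subst Positive (sym (Zimin-expand k)) (expand-positive (Zimin k))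

Zimin-layered : ∀ k → Layered k (Zimin k)
Zimin-layered zero    j (s≤s z≤n) ()
Zimin-layered (suc k) = subst (Layered (suc k)) (sym (Zimin-expand k))
  (expand-layered (Zimin-positive k) (Zimin-layered k))

-- A positive 1-interleaved word starting with 1 is a prefix of the expansion
-- of its contraction: its letters other than 1 sit exactly at the raised positions.
one-interleaved-prefix : ∀ {w} → Positive w → Interleaved 1 (1 ∷ w) →
  Σ (List ℕ) λ ys → (1 ∷ w) ++ ys ≡ expand (contract w)
one-interleaved-prefix {[]} _ _ = [] , refl
one-interleaved-prefix {zero ∷ w} (() ∷ _) _
one-interleaved-prefix {suc zero ∷ w} _ (cons _ _ _ (inj₁ (_ , 1≢1)) _) = ⊥-elim (1≢1 refl)
one-interleaved-prefix {suc zero ∷ w} _ (cons _ _ _ (inj₂ (1≢1 , _)) _) = ⊥-elim (1≢1 refl)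
one-interleaved-prefix {suc (suc y) ∷ []} _ _ = [ 1 ] , refl
one-interleaved-prefix {suc (suc y) ∷ z ∷ w} (_ ∷ _ ∷ 1≤ws)
  (cons _ _ _ _ (cons _ _ _ (inj₁ (() , _)) _))
one-interleaved-prefix {suc (suc y) ∷ z ∷ w} (_ ∷ _ ∷ 1≤ws)
  (cons _ _ _ _ (cons _ _ _ (inj₂ (_ , refl)) rest)) with one-interleaved-prefix 1≤ws rest
... | ys , e = ys , cong (λ t → 1 ∷ suc (suc y) ∷ t) e

-- Hence every positive 1-interleaved word u is a factor of expand (contract u);
-- if u does not start with 1 we may prepend a 1 without changing contract u.
one-interleaved-factor : ∀ {u} → Positive u → Interleaved 1 u → IsFactor u (expand (contract u))
one-interleaved-factor {[]} _ _ = [] , _ , refl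
one-interleaved-factor {suc zero ∷ w} (_ ∷ 1≤ws) i with one-interleaved-prefix 1≤ws i
... | ys , e = [] , ys , e
one-interleaved-factor {suc (suc y) ∷ w} 1≤u i with one-interleaved-prefix 1≤u (cons 1 _ w (inj₁ (refl , λ ())) i)
... | ys , e = [ 1 ] , ys , e

Bounded : ℕ → List ℕ → Set
Bounded k = All (λ a → 1 ≤ a × a ≤ k)

contract-bounded : ∀ {k u} → Bounded (suc k) u → Bounded k (contract u)
contract-bounded {u = []} _ = []
contract-bounded {u = suc zero ∷ u} (_ ∷ bs) = contract-bounded bs
contract-bounded {u = suc (suc y) ∷ u} ((_ , s≤s y<k) ∷ bs) = (s≤s z≤n , y<k) ∷ contract-bounded bs

layered-factor : ∀ k {u} → Bounded k u → Layered k u → IsFactor u (Zimin k)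
layered-factor zero    {[]}    _                _       = [] , [] , refl
layered-factor zero    {_ ∷ _} ((s≤s _ , ()) ∷ _) _
layered-factor (suc k) {u}     bounded          layered =
  subst (IsFactor u) (sym (Zimin-expand k))
    (factor-trans (one-interleaved-factor positive layer₁)
      (factor-expand (layered-factor k (contract-bounded bounded) (contract-layered {u = u} layered))))
  where
  positive : Positive u
  positive = All.map proj₁ bounded
  layer₁ : Interleaved 1 u
  layer₁ = subst (Interleaved 1) (deleteBelow-one positive) (layered 1 (s≤s z≤n) (s≤s z≤n))

lemma6 : (k : ℕ) → 1 ≤ k → (u : List ℕ) → u ≢ [] → All (λ a → 1 ≤ a × a ≤ k) u →
    (IsFactor u (Zimin k) ⇔ ((j : ℕ) → 1 ≤ j → j ≤ k → Interleaved j (deleteBelow j u)))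
lemma6 k _ u _ bounded = mk⇔
  (λ factor → factor-layered factor (Zimin-layered k))
  (layered-factor k bounded)
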